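{- For every positive integer $n$ with $n \neq 2$ and $n \neq 4$, the path $P_n$ on $n$ vertices is super edge-graceful. (Moreover, $P_2$ and $P_4$ are not super edge-graceful.)
   Context: All graphs are simple, finite and undirected. Let $G=(V,E)$ be a graph with $p=|V|$ vertices and $q=|E|$ edges. An edge labeling $f$ of $G$ is a bijection $f:E\to\{0,\pm1,\pm2,\ldots,\pm\frac{q-1}{2}\}$ when $q$ is odd, and $f:E\to\{\pm1,\pm2,\ldots,\pm\frac{q}{2}\}$ when $q$ is even. The induced vertex labeling is $f^*(x)=\sum_{xy\in E} f(xy)$, the sum over all edges incident with $x$. The labeling $f$ is super edge-graceful if $f^*$ is a bijection from $V$ onto $\{0,\pm1,\pm2,\ldots,\pm\frac{p-1}{2}\}$ when $p$ is odd, and onto $\{\pm1,\pm2,\ldots,\pm\frac{p}{2}\}$ when $p$ is even. A graph is super edge-graceful if it admits a super edge-graceful labeling. $P_n$ denotes the path with $n$ vertices and $n-1$ edges. -}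

module Defs where

open import Data.Nat as ℕ using (ℕ; zero; suc)
open import Data.Nat.DivMod using (_%_; _/_)
import Data.Nat.Properties as ℕP
open import Data.Integer as ℤ using (ℤ; +_; -_; _≤_)
open import Data.Fin using (Fin; toℕ; inject₁; fromℕ; _≟_)
open import Data.Product using (_×_; _,_; proj₁; proj₂; Σ; ∃; ∃-syntax)
open import Data.Sum using (_⊎_)
open import Relation.Nullary using (¬_; yes; no)
open import Relation.Binary.PropositionalEquality using (_≡_; _≢_)
open import Data.Vec.Functional using (Vector; foldr)

record Graph : Set where
  field
    p    : ℕ
    q    : ℕ
    ends : Fin q → Fin p × Fin p
    loopless : ∀ e → proj₁ (ends e) ≢ proj₂ (ends e)
    noMulti  : ∀ e e′ →
      ((proj₁ (ends e) ≡ proj₁ (ends e′) × proj₂ (ends e) ≡ proj₂ (ends e′))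
       ⊎ (proj₁ (ends e) ≡ proj₂ (ends e′) × proj₂ (ends e) ≡ proj₁ (ends e′)))
      → e ≡ e′

LabelSet : ℕ → ℤ → Set
LabelSet k z with k % 2 ℕP.≟ 0
... | yes _ = (z ≢ + 0) × (- (+ (k / 2)) ≤ z × z ≤ + (k / 2))
... | no  _ = - (+ (k / 2)) ≤ z × z ≤ + (k / 2)

BijOnto : {A : Set} → (A → ℤ) → ℕ → Set
BijOnto {A} g k =
  (∀ a → LabelSet k (g a)) ×
  (∀ a b → g a ≡ g b → a ≡ b) ×
  (∀ z → LabelSet k z → ∃[ a ] g a ≡ z)

sumℤ : ∀ {n} → Vector ℤ n → ℤ
sumℤ = foldr ℤ._+_ (+ 0)

module _ (G : Graph) where
  open Graph G

  incidentLabel : (Fin q → ℤ) → Fin p → Fin q → ℤ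
  incidentLabel f v e with v ≟ proj₁ (ends e) | v ≟ proj₂ (ends e)
  ... | yes _ | _     = f e
  ... | no _  | yes _ = f e
  ... | no _  | no _  = + 0

  induced : (Fin q → ℤ) → Fin p → ℤ
  induced f v = sumℤ (incidentLabel f v)

  IsSuperEdgeGraceful : (Fin q → ℤ) → Set
  IsSuperEdgeGraceful f = BijOnto f q × BijOnto (induced f) p

SuperEdgeGraceful : Graph → Set
SuperEdgeGraceful G = ∃[ f ] IsSuperEdgeGraceful G f

private
  open import Data.Fin.Properties using (toℕ-inject₁; inject₁-injective)
  open import Relation.Binary.PropositionalEquality using (refl; cong; sym; trans)
  open import Data.Sum using (inj₁; inj₂)
  open import Data.Empty using (⊥-elim)
  open import Data.Nat.Properties using (suc-injective)

  n≢1+n : ∀ n → n ≢ suc n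
  n≢1+n zero ()
  n≢1+n (suc n) eq = n≢1+n n (suc-injective eq)

  n≢2+n : ∀ n → n ≢ suc (suc n)
  n≢2+n zero ()
  n≢2+n (suc n) eq = n≢2+n n (suc-injective eq)

  pathLoopless : ∀ {m} (i : Fin m) → inject₁ i ≢ Data.Fin.suc i
  pathLoopless i eq = n≢1+n (toℕ i) (trans (sym (toℕ-inject₁ i)) (cong toℕ eq))

  toℕ-suc-inj₁ : ∀ {m} (i : Fin m) → toℕ (Data.Fin.suc i) ≡ suc (toℕ (inject₁ i))
  toℕ-suc-inj₁ i = cong suc (sym (toℕ-inject₁ i))

  pathNoMulti : ∀ {m} (e e′ : Fin m) →
      ((inject₁ e ≡ inject₁ e′ × Data.Fin.suc e ≡ Data.Fin.suc e′)
       ⊎ (inject₁ e ≡ Data.Fin.suc e′ × Data.Fin.suc e ≡ inject₁ e′))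
      → e ≡ e′
  pathNoMulti e e′ (inj₁ (a , _)) = inject₁-injective a
  pathNoMulti e e′ (inj₂ (a , b)) = ⊥-elim (n≢2+n (toℕ e) (trans x (cong suc (sym y))))
    where
    x : toℕ e ≡ suc (toℕ e′)
    x = trans (sym (toℕ-inject₁ e)) (cong toℕ a)
    y : suc (toℕ e) ≡ toℕ e′
    y = trans (cong toℕ b) (toℕ-inject₁ e′)

Path : ℕ → Graph
Path zero = record { p = 0 ; q = 0 ; ends = λ () ; loopless = λ () ; noMulti = λ () }
Path (suc m) = record
  { p = suc m
  ; q = m
  ; ends = λ i → inject₁ i , Data.Fin.suc i
  ; loopless = pathLoopless
  ; noMulti = pathNoMulti
  }

module Submission where

-- A labeling of the path with vertices 0, …, m and edges {i, i+1} is just the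
-- list  as = [a₀, …, a_{m-1}]  of edge labels; the induced vertex labels are
-- a₀, a₀+a₁, …, a_{m-2}+a_{m-1}, a_{m-1}  ('vertexLabels').  A function on
-- Fin n is a bijection onto a label set as soon as its list of values is a
-- permutation of a duplicate-free list enumerating that set ('pathSEG'), and
-- the label sets of odd/even size are enumerated by one or two integer
-- intervals ('enumOdd', 'enumEven').  The labelings are built from
-- zigzags  x, y, x+1, y+1, x+2, …  whose labels form two intervals and whose
-- consecutive sums form one interval when y is one more than the preceding
-- label.  P_{2h+1} is a single zigzag; P_{2h} (h ≥ 3) is two zigzags joined by
-- three edges, with the middle labels depending on the parity of h.  The
-- exceptional paths P_2 and P_4 are ruled out by looking at which edge gets 0.

open import Defs
open import Data.Nat as ℕ using (ℕ; zero; suc; _*_; z≤n; s≤s)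
import Data.Nat.Properties as ℕP
open import Data.Nat.DivMod using (_%_; _/_; m*n%n≡0; m*n/n≡m; [m+kn]%n≡m%n; +-distrib-/)
import Data.Nat.Tactic.RingSolver as NS
open import Data.Integer as ℤ using (ℤ; +_; -_; -[1+_]; _+_; _≤_; _<_; +≤+; -≤+; -<+)
import Data.Integer.Properties as ℤP
open import Data.Integer.Tactic.RingSolver using (solve-∀)
open import Data.Fin using (Fin; zero; suc; inject₁; _≟_; #_)
open import Data.List using (List; []; _∷_; _++_; [_]; length; tabulate; lookup)
open import Data.List.Properties using (tabulate-cong; tabulate-lookup; length-++; ++-assoc)
open import Data.List.Membership.Propositional using (_∈_; _∉_)
open import Data.List.Membership.Propositional.Properties using (∈-tabulate⁺; ∈-tabulate⁻; ∈-++⁻; ∈-++⁺ˡ; ∈-++⁺ʳ)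
open import Data.List.Relation.Unary.Any using (here; there)
open import Data.List.Relation.Unary.All.Properties using (¬Any⇒All¬; tabulate⁻)
open import Data.List.Relation.Unary.Unique.Propositional using (Unique; []; _∷_)
import Data.List.Relation.Unary.Unique.Propositional.Properties as Unique
open import Data.List.Relation.Binary.Permutation.Propositional using (_↭_; prep; ↭-refl; ↭-sym; ↭-trans; ↭-reflexive; ↭⇒↭ₛ; module PermutationReasoning)
open import Data.List.Relation.Binary.Permutation.Propositional.Properties using (∈-resp-↭; shift; ++-comm; ++⁺; ++-commutativeMonoid)
open import Data.List.Relation.Binary.Permutation.Setoid.Properties using (Unique-resp-↭)
open import Algebra.Solver.CommutativeMonoid (++-commutativeMonoid {A = ℤ}) using (Expr; prove; var; _⊕_)
import Data.Vec as V
open import Data.Vec.Functional using (Vector)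
open import Data.Product using (_×_; _,_; proj₁; proj₂; ∃-syntax)
open import Data.Sum using (_⊎_; inj₁; inj₂)
open import Data.Empty using (⊥-elim)
open import Function using (_∘_; _⇔_; mk⇔; Equivalence)
open import Relation.Nullary using (¬_; yes; no)
open import Relation.Binary.PropositionalEquality hiding ([_])
open import Relation.Binary.PropositionalEquality.Properties using (setoid)

sumℤ-cong : ∀ {n} {g h : Vector ℤ n} → (∀ i → g i ≡ h i) → sumℤ g ≡ sumℤ h
sumℤ-cong {zero}  _  = refl
sumℤ-cong {suc n} eq = cong₂ _+_ (eq zero) (sumℤ-cong (eq ∘ suc))

sumℤ-zero : ∀ {n} {g : Vector ℤ n} → (∀ i → g i ≡ + 0) → sumℤ g ≡ + 0
sumℤ-zero {zero}  _  = refl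
sumℤ-zero {suc n} eq = cong₂ _+_ (eq zero) (sumℤ-zero (eq ∘ suc))

-- atFirst p w: the contribution of the first edge (label p) of a path to vertex
-- w+1; only vertex 1 is incident with that edge.
atFirst : ∀ {n} → ℤ → Fin n → ℤ
atFirst p zero    = p
atFirst p (suc _) = + 0

atFirst-zero : ∀ {n} (w : Fin n) → atFirst (+ 0) w ≡ + 0
atFirst-zero zero    = refl
atFirst-zero (suc _) = refl

module _ {m : ℕ} (f : Fin (suc m) → ℤ) where

  private
    P₁ P₂ : Graph
    P₁ = Path (suc m)
    P₂ = Path (suc (suc m))

  induced-zero : induced P₂ f zero ≡ f zero
  induced-zero =
    trans (cong (λ s → f zero + s) (sumℤ-zero {g = λ e → incidentLabel P₂ f zero (suc e)} λ _ → refl))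
          (ℤP.+-identityʳ (f zero))

  label-first : ∀ w → incidentLabel P₂ f (suc w) zero ≡ atFirst (f zero) w
  label-first zero    = refl
  label-first (suc _) = refl

  label-shift : ∀ w e → incidentLabel P₂ f (suc w) (suc e) ≡ incidentLabel P₁ (f ∘ suc) w e
  label-shift w e with w ≟ inject₁ e | w ≟ suc e
  ... | yes _ | _     = refl
  ... | no _  | yes _ = refl
  ... | no _  | no _  = refl

  induced-suc : ∀ w → induced P₂ f (suc w) ≡ atFirst (f zero) w + induced P₁ (f ∘ suc) w
  induced-suc w = cong₂ _+_ (label-first w) (sumℤ-cong (label-shift w))

-- steps p as: the sums of consecutive labels in  p ∷ as , i.e. the labels of
-- the vertices entered by the edges of  as  when the previous edge has label p.
steps : ℤ → List ℤ → List ℤ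
steps p []       = []
steps p (a ∷ as) = p + a ∷ steps a as

-- final p as: the last label of  p ∷ as , which is the label of the end vertex.
final : ℤ → List ℤ → ℤ
final p []       = p
final p (a ∷ as) = final a as

vertexLabels : List ℤ → List ℤ
vertexLabels as = steps (+ 0) as ++ [ final (+ 0) as ]

-- Reading the induced labels of P_{m+1} vertex by vertex gives vertexLabels;
-- the general form allows a preceding edge of label p at vertex 0.
induced-path-after : ∀ p as →
  tabulate (λ w → atFirst p w + induced (Path (suc (length as))) (lookup as) w)
    ≡ steps p as ++ [ final p as ]
induced-path-after p []       = cong [_] (ℤP.+-identityʳ p)
induced-path-after p (a ∷ as) =
  cong₂ _∷_ (cong (λ s → p + s) (induced-zero (lookup (a ∷ as))))
    (trans (tabulate-cong λ w → trans (ℤP.+-identityˡ _) (induced-suc (lookup (a ∷ as)) w))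
           (induced-path-after a as))

induced-path : ∀ as → tabulate (induced (Path (suc (length as))) (lookup as)) ≡ vertexLabels as
induced-path as = trans (tabulate-cong no-first-edge) (induced-path-after (+ 0) as)
  where
  f* : Fin (suc (length as)) → ℤ
  f* = induced (Path (suc (length as))) (lookup as)
  no-first-edge : ∀ w → f* w ≡ atFirst (+ 0) w + f* w
  no-first-edge w = sym (trans (cong (_+ f* w) (atFirst-zero w)) (ℤP.+-identityˡ (f* w)))

record Enumerates (k : ℕ) (cs : List ℤ) : Set where
  field
    unique   : Unique cs
    sound    : ∀ {z} → z ∈ cs → LabelSet k z
    complete : ∀ {z} → LabelSet k z → z ∈ cs

tabulate-injective : ∀ {n} {g : Fin n → ℤ} → Unique (tabulate g) → ∀ i j → g i ≡ g j → i ≡ j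
tabulate-injective _          zero    zero    _  = refl
tabulate-injective (g₀∉ ∷ _)  zero    (suc j) eq = ⊥-elim (tabulate⁻ g₀∉ j eq)
tabulate-injective (g₀∉ ∷ _)  (suc i) zero    eq = ⊥-elim (tabulate⁻ g₀∉ i (sym eq))
tabulate-injective (_ ∷ rest) (suc i) (suc j) eq = cong suc (tabulate-injective rest i j eq)

bijOnto : ∀ {n k cs} (g : Fin n → ℤ) → tabulate g ↭ cs → Enumerates k cs → BijOnto g k
bijOnto g g↭cs E =
  (λ i → sound (∈-resp-↭ g↭cs (∈-tabulate⁺ i))) ,
  tabulate-injective (Unique-resp-↭ (setoid ℤ) (↭⇒↭ₛ (↭-sym g↭cs)) unique) ,
  (λ z z∈ → let (i , z≡gi) = ∈-tabulate⁻ (∈-resp-↭ (↭-sym g↭cs) (complete z∈)) in i , sym z≡gi)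
  where open Enumerates E

pathSEG : ∀ {m cs ds} (as : List ℤ) → length as ≡ m →
  Enumerates m cs → Enumerates (suc m) ds → as ↭ cs → vertexLabels as ↭ ds →
  SuperEdgeGraceful (Path (suc m))
pathSEG as refl edgeSet vertexSet as↭cs vs↭ds =
  lookup as ,
  bijOnto _ (subst (_↭ _) (sym (tabulate-lookup as)) as↭cs) edgeSet ,
  bijOnto _ (subst (_↭ _) (sym (induced-path as)) vs↭ds) vertexSet

interval : ℤ → ℕ → List ℤ
interval a zero    = []
interval a (suc l) = a ∷ interval (ℤ.suc a) l

+-suc-shift : ∀ a l → a + + suc l ≡ ℤ.suc a + + l
+-suc-shift a l = lemma a (+ l)
  where
  lemma : ∀ a L → a + (+ 1 + L) ≡ (+ 1 + a) + L
  lemma = solve-∀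

∈-interval⁻ : ∀ {z} a l → z ∈ interval a l → a ≤ z × z < a + + l
∈-interval⁻ a (suc l) (here refl) =
  ℤP.≤-refl , ℤP.suc[i]≤j⇒i<j (subst (ℤ.suc a ≤_) (sym (+-suc-shift a l)) (ℤP.i≤i+j (ℤ.suc a) (+ l)))
∈-interval⁻ a (suc l) (there z∈) =
  let (a<z , z<end) = ∈-interval⁻ (ℤ.suc a) l z∈
  in ℤP.≤-trans (ℤP.i≤suc[i] a) a<z , subst (_ <_) (sym (+-suc-shift a l)) z<end

∈-interval⁺ : ∀ {z} a l → a ≤ z → z < a + + l → z ∈ interval a l
∈-interval⁺ {z} a zero    a≤z z<a = ⊥-elim (ℤP.<-irrefl refl (ℤP.≤-<-trans a≤z (subst (z <_) (ℤP.+-identityʳ a) z<a)))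
∈-interval⁺ {z} a (suc l) a≤z z<end with z ℤ.≟ a
... | yes z≡a = here z≡a
... | no  z≢a = there (∈-interval⁺ (ℤ.suc a) l (ℤP.i<j⇒suc[i]≤j (ℤP.≤∧≢⇒< a≤z (z≢a ∘ sym)))
                                               (subst (z <_) (+-suc-shift a l) z<end))

interval-unique : ∀ a l → Unique (interval a l)
interval-unique a zero    = []
interval-unique a (suc l) = ¬Any⇒All¬ _ a∉rest ∷ interval-unique (ℤ.suc a) l
  where
  a∉rest : a ∉ interval (ℤ.suc a) l
  a∉rest a∈ = ℤP.<-irrefl refl (ℤP.suc[i]≤j⇒i<j (proj₁ (∈-interval⁻ (ℤ.suc a) l a∈)))

interval-join : ∀ a l {b l′ rest} → b ≡ a + + l → rest ≡ interval b l′ →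
  interval a l ++ rest ≡ interval a (l ℕ.+ l′)
interval-join a zero    refl refl = cong (λ c → interval c _) (ℤP.+-identityʳ a)
interval-join a (suc l) b≡ rest≡ =
  cong (a ∷_) (interval-join (ℤ.suc a) l (trans b≡ (+-suc-shift a l)) rest≡)

odd-remainder : ∀ h → suc (h * 2) % 2 ≡ 1
odd-remainder h = [m+kn]%n≡m%n 1 h 2

odd-half : ∀ h → suc (h * 2) / 2 ≡ h
odd-half h =
  trans (+-distrib-/ 1 (h * 2) (subst (λ r → 1 ℕ.+ r ℕ.< 2) (sym (m*n%n≡0 h 2)) ℕP.≤-refl))
        (m*n/n≡m h 2)

labelSet-odd : ∀ h z → LabelSet (suc (h * 2)) z ⇔ (- (+ h) ≤ z × z ≤ + h)
labelSet-odd h z with suc (h * 2) % 2 ℕP.≟ 0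
... | yes rem≡0 = ⊥-elim (ℕP.1+n≢0 (trans (sym (odd-remainder h)) rem≡0))
... | no _ rewrite odd-half h = mk⇔ (λ x → x) (λ x → x)

even-half : ∀ h → h * 2 / 2 ≡ h
even-half h = m*n/n≡m h 2

labelSet-even : ∀ h z → LabelSet (h * 2) z ⇔ (z ≢ + 0 × - (+ h) ≤ z × z ≤ + h)
labelSet-even h z with h * 2 % 2 ℕP.≟ 0
... | no rem≢0 = ⊥-elim (rem≢0 (m*n%n≡0 h 2))
... | yes _ rewrite even-half h = mk⇔ (λ x → x) (λ x → x)

<-suc⇒≤ : ∀ {z b} → z < ℤ.suc b → z ≤ b
<-suc⇒≤ {b = b} z<sb = subst (_ ≤_) (ℤP.pred-suc b) (ℤP.i<j⇒i≤pred[j] z<sb)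

≤⇒<-suc : ∀ {z b} → z ≤ b → z < ℤ.suc b
≤⇒<-suc {b = b} z≤b = ℤP.i≤pred[j]⇒i<j (subst (_ ≤_) (sym (ℤP.pred-suc b)) z≤b)

odd-top : ∀ h → - (+ h) + + suc (h * 2) ≡ + suc h
odd-top h = trans (cong (λ t → - (+ h) + (+ 1 + t)) (ℤP.pos-* h 2)) (lemma (+ h))
  where
  lemma : ∀ H → - H + (+ 1 + H ℤ.* + 2) ≡ + 1 + H
  lemma = solve-∀

enumOdd : ∀ h → Enumerates (suc (h * 2)) (interval (- (+ h)) (suc (h * 2)))
enumOdd h = record
  { unique   = interval-unique _ _
  ; sound    = λ z∈ → let (lo , hi) = ∈-interval⁻ _ _ z∈ in
      Equivalence.from (labelSet-odd h _) (lo , <-suc⇒≤ (subst (_ <_) (odd-top h) hi))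
  ; complete = λ z∈L → let (lo , hi) = Equivalence.to (labelSet-odd h _) z∈L in
      ∈-interval⁺ _ _ lo (subst (_ <_) (sym (odd-top h)) (≤⇒<-suc hi))
  }

enumEven : ∀ h → Enumerates (h * 2) (interval (- (+ h)) h ++ interval (+ 1) h)
enumEven h = record
  { unique   = Unique.++⁺ (interval-unique _ _) (interval-unique _ _)
                 (λ (z∈neg , z∈pos) → ℤP.<-asym (negative z∈neg) (positive z∈pos))
  ; sound    = sound
  ; complete = complete
  }
  where
  -h+h≡0 : - (+ h) + + h ≡ + 0
  -h+h≡0 = ℤP.+-inverseˡ (+ h)

  negative : ∀ {z} → z ∈ interval (- (+ h)) h → z < + 0
  negative z∈ = subst (_ <_) -h+h≡0 (proj₂ (∈-interval⁻ _ _ z∈))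

  positive : ∀ {z} → z ∈ interval (+ 1) h → + 0 < z
  positive z∈ = ℤP.suc[i]≤j⇒i<j (proj₁ (∈-interval⁻ _ _ z∈))

  sound : ∀ {z} → z ∈ interval (- (+ h)) h ++ interval (+ 1) h → LabelSet (h * 2) z
  sound {z} z∈ = Equivalence.from (labelSet-even h z) (bounds (∈-++⁻ (interval (- (+ h)) h) z∈))
    where
    bounds : z ∈ interval (- (+ h)) h ⊎ z ∈ interval (+ 1) h → z ≢ + 0 × - (+ h) ≤ z × z ≤ + h
    bounds (inj₁ z∈neg) =
      (λ { refl → ℤP.<-irrefl refl (negative z∈neg) }) ,
      proj₁ (∈-interval⁻ _ _ z∈neg) ,
      ℤP.≤-trans (ℤP.<⇒≤ (negative z∈neg)) (+≤+ z≤n)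
    bounds (inj₂ z∈pos) =
      (λ { refl → ℤP.<-irrefl refl (positive z∈pos) }) ,
      ℤP.≤-trans ℤP.neg-≤-pos (ℤP.<⇒≤ (positive z∈pos)) ,
      <-suc⇒≤ (proj₂ (∈-interval⁻ _ _ z∈pos))

  complete : ∀ {z} → LabelSet (h * 2) z → z ∈ interval (- (+ h)) h ++ interval (+ 1) h
  complete {z} z∈L with Equivalence.to (labelSet-even h z) z∈L
  complete {+ zero}   _ | z≢0 , _  , _  = ⊥-elim (z≢0 refl)
  complete {+ suc n}  _ | _   , _  , hi =
    ∈-++⁺ʳ (interval (- (+ h)) h) (∈-interval⁺ _ _ (+≤+ (s≤s z≤n)) (≤⇒<-suc hi))
  complete { -[1+ n ]} _ | _  , lo , _  =
    ∈-++⁺ˡ (∈-interval⁺ _ _ lo (subst (_ <_) (sym -h+h≡0) -<+))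

zig : ℤ → ℤ → ℕ → List ℤ
zig x y zero    = []
zig x y (suc l) = x ∷ zig y (ℤ.suc x) l

length-zig : ∀ x y l → length (zig x y l) ≡ l
length-zig x y zero    = refl
length-zig x y (suc l) = cong suc (length-zig y (ℤ.suc x) l)

zig-even-↭ : ∀ x y j → zig x y (j ℕ.+ j) ↭ interval x j ++ interval y j
zig-even-↭ x y zero    = ↭-refl
zig-even-↭ x y (suc j) rewrite ℕP.+-suc j j =
  prep x (↭-trans (prep y (zig-even-↭ (ℤ.suc x) (ℤ.suc y) j))
                  (↭-sym (shift y (interval (ℤ.suc x) j) (interval (ℤ.suc y) j))))

zig-odd-↭ : ∀ x y j → zig x y (suc (j ℕ.+ j)) ↭ interval x (suc j) ++ interval y j
zig-odd-↭ x y j = prep x (↭-trans (zig-even-↭ y (ℤ.suc x) j) (++-comm (interval y j) _))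

steps-zig : ∀ p x l → steps p (zig x (ℤ.suc p) l) ≡ interval (p + x) l
steps-zig p x zero    = refl
steps-zig p x (suc l) = cong (p + x ∷_) (trans (steps-zig x (ℤ.suc p) l) (cong (λ c → interval c l) (lemma p x)))
  where
  lemma : ∀ p x → x + (+ 1 + p) ≡ + 1 + (p + x)
  lemma = solve-∀

final-zig-even : ∀ p x j → final p (zig x (ℤ.suc p) (j ℕ.+ j)) ≡ p + + j
final-zig-even p x zero    = sym (ℤP.+-identityʳ p)
final-zig-even p x (suc j) rewrite ℕP.+-suc j j =
  trans (final-zig-even (ℤ.suc p) (ℤ.suc x) j) (sym (+-suc-shift p j))

final-zig-odd : ∀ p x j → final p (zig x (ℤ.suc p) (suc (j ℕ.+ j))) ≡ x + + j
final-zig-odd p x j = final-zig-even x (ℤ.suc p) j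

steps-++ : ∀ p xs ys → steps p (xs ++ ys) ≡ steps p xs ++ steps (final p xs) ys
steps-++ p []       ys = refl
steps-++ p (x ∷ xs) ys = cong (p + x ∷_) (steps-++ x xs ys)

final-++ : ∀ p xs ys → final p (xs ++ ys) ≡ final (final p xs) ys
final-++ p []       ys = refl
final-++ p (x ∷ xs) ys = final-++ x xs ys

double : ∀ j → j ℕ.+ j ≡ j * 2
double = NS.solve-∀

-- P_{2h+1}: the zigzag  -h, 1, -h+1, 2, …, -1, h  has edge labels [-h,-1] ++ [1,h]
-- and vertex labels -h, -h+1, …, h in order.
oddPath : ∀ h → SuperEdgeGraceful (Path (suc (h * 2)))
oddPath h =
  pathSEG edges (trans (length-zig _ _ (h ℕ.+ h)) (double h)) (enumEven h) (enumOdd h)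
    (zig-even-↭ (- (+ h)) (+ 1) h) (↭-reflexive vertices)
  where
  edges : List ℤ
  edges = zig (- (+ h)) (+ 1) (h ℕ.+ h)

  vertices : vertexLabels edges ≡ interval (- (+ h)) (suc (h * 2))
  vertices = begin
    steps (+ 0) edges ++ [ final (+ 0) edges ]
      ≡⟨ cong₂ (λ s t → s ++ [ t ]) (steps-zig (+ 0) (- (+ h)) (h ℕ.+ h)) (final-zig-even (+ 0) (- (+ h)) h) ⟩
    interval (+ 0 + - (+ h)) (h ℕ.+ h) ++ [ + 0 + + h ]
      ≡⟨ cong (λ a → interval a (h ℕ.+ h) ++ [ + 0 + + h ]) (ℤP.+-identityˡ (- (+ h))) ⟩
    interval (- (+ h)) (h ℕ.+ h) ++ interval (+ 0 + + h) 1
      ≡⟨ interval-join (- (+ h)) (h ℕ.+ h) (top (+ h)) refl ⟩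
    interval (- (+ h)) (h ℕ.+ h ℕ.+ 1)
      ≡⟨ cong (interval (- (+ h))) (count h) ⟩
    interval (- (+ h)) (suc (h * 2)) ∎
    where
    open ≡-Reasoning
    top : ∀ H → + 0 + H ≡ - H + (H + H)
    top = solve-∀
    count : ∀ i → i ℕ.+ i ℕ.+ 1 ≡ suc (i * 2)
    count = NS.solve-∀

twoZigs : ℤ → ℕ → ℤ → ℤ → ℤ → ℤ → ℕ → List ℤ
twoZigs x₁ l₁ c d e x₂ l₂ = - (+ 1) ∷ (zig x₁ (+ 0) l₁ ++ c ∷ d ∷ e ∷ zig x₂ (ℤ.suc e) l₂)

length-twoZigs : ∀ x₁ l₁ c d e x₂ l₂ → length (twoZigs x₁ l₁ c d e x₂ l₂) ≡ suc (l₁ ℕ.+ (3 ℕ.+ l₂))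
length-twoZigs x₁ l₁ c d e x₂ l₂ =
  cong suc (trans (length-++ (zig x₁ (+ 0) l₁)) (cong₂ (λ m n → m ℕ.+ (3 ℕ.+ n)) (length-zig _ _ l₁) (length-zig _ _ l₂)))

-- The vertex labels of  twoZigs  are -1, an interval, the three sums around
-- c, d, e, a second interval and the final label; each value is passed in as a
-- hypothesis so that it can be stated in closed form.
vertexLabels-twoZigs : ∀ x₁ l₁ c d e x₂ l₂ {s₁ u v w s₂ t} →
  - (+ 1) + x₁ ≡ s₁ → final (- (+ 1)) (zig x₁ (+ 0) l₁) + c ≡ u → c + d ≡ v → d + e ≡ w →
  e + x₂ ≡ s₂ → final e (zig x₂ (ℤ.suc e) l₂) ≡ t →
  vertexLabels (twoZigs x₁ l₁ c d e x₂ l₂) ≡ - (+ 1) ∷ interval s₁ l₁ ++ u ∷ v ∷ w ∷ interval s₂ l₂ ++ [ t ]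
vertexLabels-twoZigs x₁ l₁ c d e x₂ l₂ refl refl refl refl refl refl = cong (- (+ 1) ∷_) (begin
    steps (- (+ 1)) (Z₁ ++ rest) ++ [ final (- (+ 1)) (Z₁ ++ rest) ]
      ≡⟨ cong₂ (λ s t → s ++ [ t ]) (steps-++ (- (+ 1)) Z₁ rest) (final-++ (- (+ 1)) Z₁ rest) ⟩
    (steps (- (+ 1)) Z₁ ++ steps (final (- (+ 1)) Z₁) rest) ++ [ final e Z₂ ]
      ≡⟨ ++-assoc (steps (- (+ 1)) Z₁) _ _ ⟩
    steps (- (+ 1)) Z₁ ++ (steps (final (- (+ 1)) Z₁) rest ++ [ final e Z₂ ])
      ≡⟨ cong₂ (λ s t → s ++ final (- (+ 1)) Z₁ + c ∷ c + d ∷ d + e ∷ t ++ [ final e Z₂ ])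
               (steps-zig (- (+ 1)) x₁ l₁) (steps-zig e x₂ l₂) ⟩
    interval (- (+ 1) + x₁) l₁ ++ final (- (+ 1)) Z₁ + c ∷ c + d ∷ d + e ∷ interval (e + x₂) l₂ ++ [ final e Z₂ ] ∎)
  where
  open ≡-Reasoning
  Z₁ Z₂ rest : List ℤ
  Z₁   = zig x₁ (+ 0) l₁
  Z₂   = zig x₂ (ℤ.suc e) l₂
  rest = c ∷ d ∷ e ∷ Z₂

+1-on-right : ∀ n → + suc n ≡ + n + + 1
+1-on-right n = ℤP.+-comm (+ 1) (+ n)

-- P_{2h} for h = 2j+3, with edge list
--   -1, zig(-(2j+2), 0), j, j+1, j+2, zig(-(j+1), j+3)
-- whose edge labels are [-(2j+2), 2j+2] and whose vertex labels are
--   -1, [-(2j+3), -3], -2, 2j+1, 2j+3, [1, 2j], 2j+2.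
module EvenPathOddHalf (j : ℕ) where

  h′ : ℕ
  h′ = 2 ℕ.+ (j ℕ.+ j)

  x₁ x₂ c d e : ℤ
  x₁ = - (+ h′)
  c  = + j
  d  = + (1 ℕ.+ j)
  e  = + (2 ℕ.+ j)
  x₂ = - (+ (1 ℕ.+ j))

  l₁ l₂ : ℕ
  l₁ = suc (j ℕ.+ j)
  l₂ = j ℕ.+ j

  edges : List ℤ
  edges = twoZigs x₁ l₁ c d e x₂ l₂

  edges-↭ : edges ↭ interval x₁ (suc (h′ * 2))
  edges-↭ = begin
    edges
      ↭⟨ prep _ (++⁺ (zig-odd-↭ x₁ (+ 0) j) (prep _ (prep _ (prep _ (zig-even-↭ x₂ _ j))))) ⟩
    [ - (+ 1) ] ++ ((A ++ D) ++ ([ c ] ++ ([ d ] ++ ([ e ] ++ (B ++ H)))))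
      ↭⟨ prove 8 (v0 ⊕ ((v1 ⊕ v2) ⊕ (v3 ⊕ (v4 ⊕ (v5 ⊕ (v6 ⊕ v7))))))
                 (v1 ⊕ (v6 ⊕ (v0 ⊕ (v2 ⊕ (v3 ⊕ (v4 ⊕ (v5 ⊕ v7)))))))
                 ([ - (+ 1) ] V.∷ A V.∷ D V.∷ [ c ] V.∷ [ d ] V.∷ [ e ] V.∷ B V.∷ H V.∷ V.[]) ⟩
    A ++ (B ++ ([ - (+ 1) ] ++ (D ++ ([ c ] ++ ([ d ] ++ ([ e ] ++ H))))))
      ≡⟨ interval-join x₁ (suc j) (e₁ (+ j)) (interval-join x₂ j (e₂ (+ j)) (interval-join (- (+ 1)) 1 refl
           (interval-join (+ 0) j (sym (ℤP.+-identityˡ (+ j))) (interval-join c 1 (+1-on-right j)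
           (interval-join d 1 (+1-on-right (1 ℕ.+ j)) (interval-join e 1 (+1-on-right (2 ℕ.+ j)) refl)))))) ⟩
    interval x₁ (suc j ℕ.+ (j ℕ.+ (1 ℕ.+ (j ℕ.+ (1 ℕ.+ (1 ℕ.+ (1 ℕ.+ j)))))))
      ≡⟨ cong (interval x₁) (count j) ⟩
    interval x₁ (suc (h′ * 2)) ∎
    where
    open PermutationReasoning
    v0 v1 v2 v3 v4 v5 v6 v7 : Expr 8
    v0 = var (# 0); v1 = var (# 1); v2 = var (# 2); v3 = var (# 3)
    v4 = var (# 4); v5 = var (# 5); v6 = var (# 6); v7 = var (# 7)
    A D B H : List ℤ
    A = interval x₁ (suc j)
    D = interval (+ 0) j
    B = interval x₂ j
    H = interval (+ (3 ℕ.+ j)) j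
    e₁ : ∀ J → - (+ 1 + J) ≡ - (+ 2 + (J + J)) + (+ 1 + J)
    e₁ = solve-∀
    e₂ : ∀ J → - (+ 1) ≡ - (+ 1 + J) + J
    e₂ = solve-∀
    count : ∀ i → suc i ℕ.+ (i ℕ.+ (1 ℕ.+ (i ℕ.+ (1 ℕ.+ (1 ℕ.+ (1 ℕ.+ i)))))) ≡ suc ((2 ℕ.+ (i ℕ.+ i)) * 2)
    count = NS.solve-∀

  h : ℕ
  h = suc h′

  vertices-↭ : vertexLabels edges ↭ interval (- (+ h)) h ++ interval (+ 1) h
  vertices-↭ = begin
    vertexLabels edges
      ≡⟨ vertexLabels-twoZigs x₁ l₁ c d e x₂ l₂ (s₁ (+ j)) (trans (cong (_+ c) (final-zig-odd (- (+ 1)) x₁ j)) (u (+ j)))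
           (v (+ j)) (w (+ j)) (s₂ (+ j)) (trans (final-zig-even e x₂ j) (t (+ j))) ⟩
    [ - (+ 1) ] ++ (N ++ ([ - (+ 2) ] ++ ([ + (1 ℕ.+ (j ℕ.+ j)) ] ++ ([ + h ] ++ (P ++ [ + h′ ])))))
      ↭⟨ prove 7 (v0 ⊕ (v1 ⊕ (v2 ⊕ (v3 ⊕ (v4 ⊕ (v5 ⊕ v6))))))
                 ((v1 ⊕ (v2 ⊕ v0)) ⊕ (v5 ⊕ (v3 ⊕ (v6 ⊕ v4))))
                 ([ - (+ 1) ] V.∷ N V.∷ [ - (+ 2) ] V.∷ [ + (1 ℕ.+ (j ℕ.+ j)) ] V.∷ [ + h ] V.∷ P V.∷ [ + h′ ] V.∷ V.[]) ⟩
    (N ++ ([ - (+ 2) ] ++ [ - (+ 1) ])) ++ (P ++ ([ + (1 ℕ.+ (j ℕ.+ j)) ] ++ ([ + h′ ] ++ [ + h ])))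
      ≡⟨ cong₂ _++_ (interval-join (- (+ h)) (suc (j ℕ.+ j)) (n₁ (+ j)) (interval-join (- (+ 2)) 1 refl refl))
                    (interval-join (+ 1) (j ℕ.+ j) refl (interval-join _ 1 (+1-on-right _) (interval-join _ 1 (+1-on-right _) refl))) ⟩
    interval (- (+ h)) (suc (j ℕ.+ j) ℕ.+ (1 ℕ.+ 1)) ++ interval (+ 1) (j ℕ.+ j ℕ.+ (1 ℕ.+ (1 ℕ.+ 1)))
      ≡⟨ cong₂ (λ m n → interval (- (+ h)) m ++ interval (+ 1) n) (count₁ j) (count₂ j) ⟩
    interval (- (+ h)) h ++ interval (+ 1) h ∎
    where
    open PermutationReasoning
    v0 v1 v2 v3 v4 v5 v6 : Expr 7
    v0 = var (# 0); v1 = var (# 1); v2 = var (# 2); v3 = var (# 3)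
    v4 = var (# 4); v5 = var (# 5); v6 = var (# 6)
    N P : List ℤ
    N = interval (- (+ h)) (suc (j ℕ.+ j))
    P = interval (+ 1) (j ℕ.+ j)
    s₁ : ∀ J → - (+ 1) + - (+ 2 + (J + J)) ≡ - (+ 3 + (J + J))
    s₁ = solve-∀
    u : ∀ J → (- (+ 2 + (J + J)) + J) + J ≡ - (+ 2)
    u = solve-∀
    v : ∀ J → J + (+ 1 + J) ≡ + 1 + (J + J)
    v = solve-∀
    w : ∀ J → (+ 1 + J) + (+ 2 + J) ≡ + 3 + (J + J)
    w = solve-∀
    s₂ : ∀ J → (+ 2 + J) + - (+ 1 + J) ≡ + 1
    s₂ = solve-∀
    t : ∀ J → (+ 2 + J) + J ≡ + 2 + (J + J)
    t = solve-∀
    n₁ : ∀ J → - (+ 2) ≡ - (+ 3 + (J + J)) + (+ 1 + (J + J))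
    n₁ = solve-∀
    count₁ : ∀ j → suc (j ℕ.+ j) ℕ.+ (1 ℕ.+ 1) ≡ 3 ℕ.+ (j ℕ.+ j)
    count₁ = NS.solve-∀
    count₂ : ∀ j → j ℕ.+ j ℕ.+ (1 ℕ.+ (1 ℕ.+ 1)) ≡ 3 ℕ.+ (j ℕ.+ j)
    count₂ = NS.solve-∀

  superEdgeGraceful : SuperEdgeGraceful (Path (h * 2))
  superEdgeGraceful =
    pathSEG edges (trans (length-twoZigs x₁ l₁ c d e x₂ l₂) (count j)) (enumOdd h′) (enumEven h) edges-↭ vertices-↭
    where
    count : ∀ i → 2 ℕ.+ (i ℕ.+ i ℕ.+ (3 ℕ.+ (i ℕ.+ i))) ≡ suc ((2 ℕ.+ (i ℕ.+ i)) * 2)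
    count = NS.solve-∀

-- P_{2h} for h = 2j+4, with edge list
--   -1, zig(-(2j+3), 0), j+2, j+1, j+3, zig(-(j+2), j+4)
-- whose edge labels are [-(2j+3), 2j+3] and whose vertex labels are
--   -1, [-(2j+4), -3], 2j+2, 2j+3, 2j+4, [1, 2j+1], -2.
module EvenPathEvenHalf (j : ℕ) where

  h′ : ℕ
  h′ = 3 ℕ.+ (j ℕ.+ j)

  x₁ x₂ c d e : ℤ
  x₁ = - (+ h′)
  c  = + (2 ℕ.+ j)
  d  = + (1 ℕ.+ j)
  e  = + (3 ℕ.+ j)
  x₂ = - (+ (2 ℕ.+ j))

  l₁ l₂ : ℕ
  l₁ = suc j ℕ.+ suc j
  l₂ = suc (j ℕ.+ j)

  edges : List ℤ
  edges = twoZigs x₁ l₁ c d e x₂ l₂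

  edges-↭ : edges ↭ interval x₁ (suc (h′ * 2))
  edges-↭ = begin
    edges
      ↭⟨ prep _ (++⁺ (zig-even-↭ x₁ (+ 0) (suc j)) (prep _ (prep _ (prep _ (zig-odd-↭ x₂ _ j))))) ⟩
    [ - (+ 1) ] ++ ((A ++ D) ++ ([ c ] ++ ([ d ] ++ ([ e ] ++ (B ++ H)))))
      ↭⟨ prove 8 (v0 ⊕ ((v1 ⊕ v2) ⊕ (v3 ⊕ (v4 ⊕ (v5 ⊕ (v6 ⊕ v7))))))
                 (v1 ⊕ (v6 ⊕ (v0 ⊕ (v2 ⊕ (v4 ⊕ (v3 ⊕ (v5 ⊕ v7)))))))
                 ([ - (+ 1) ] V.∷ A V.∷ D V.∷ [ c ] V.∷ [ d ] V.∷ [ e ] V.∷ B V.∷ H V.∷ V.[]) ⟩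
    A ++ (B ++ ([ - (+ 1) ] ++ (D ++ ([ d ] ++ ([ c ] ++ ([ e ] ++ H))))))
      ≡⟨ interval-join x₁ (suc j) (e₁ (+ j)) (interval-join x₂ (suc j) (e₂ (+ j)) (interval-join (- (+ 1)) 1 refl
           (interval-join (+ 0) (suc j) refl (interval-join d 1 (+1-on-right (1 ℕ.+ j))
           (interval-join c 1 (+1-on-right (2 ℕ.+ j)) (interval-join e 1 (+1-on-right (3 ℕ.+ j)) refl)))))) ⟩
    interval x₁ (suc j ℕ.+ (suc j ℕ.+ (1 ℕ.+ (suc j ℕ.+ (1 ℕ.+ (1 ℕ.+ (1 ℕ.+ j)))))))
      ≡⟨ cong (interval x₁) (count j) ⟩
    interval x₁ (suc (h′ * 2)) ∎
    where
    open PermutationReasoning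
    v0 v1 v2 v3 v4 v5 v6 v7 : Expr 8
    v0 = var (# 0); v1 = var (# 1); v2 = var (# 2); v3 = var (# 3)
    v4 = var (# 4); v5 = var (# 5); v6 = var (# 6); v7 = var (# 7)
    A D B H : List ℤ
    A = interval x₁ (suc j)
    D = interval (+ 0) (suc j)
    B = interval x₂ (suc j)
    H = interval (+ (4 ℕ.+ j)) j
    e₁ : ∀ J → - (+ 2 + J) ≡ - (+ 3 + (J + J)) + (+ 1 + J)
    e₁ = solve-∀
    e₂ : ∀ J → - (+ 1) ≡ - (+ 2 + J) + (+ 1 + J)
    e₂ = solve-∀
    count : ∀ i → suc i ℕ.+ (suc i ℕ.+ (1 ℕ.+ (suc i ℕ.+ (1 ℕ.+ (1 ℕ.+ (1 ℕ.+ i)))))) ≡ suc ((3 ℕ.+ (i ℕ.+ i)) * 2)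
    count = NS.solve-∀

  h : ℕ
  h = suc h′

  vertices-↭ : vertexLabels edges ↭ interval (- (+ h)) h ++ interval (+ 1) h
  vertices-↭ = begin
    vertexLabels edges
      ≡⟨ vertexLabels-twoZigs x₁ l₁ c d e x₂ l₂ (s₁ (+ j)) (trans (cong (_+ c) (final-zig-even (- (+ 1)) x₁ (suc j))) (u (+ j)))
           (v (+ j)) (w (+ j)) (s₂ (+ j)) (trans (final-zig-odd e x₂ j) (t (+ j))) ⟩
    [ - (+ 1) ] ++ (N ++ ([ + (2 ℕ.+ (j ℕ.+ j)) ] ++ ([ + h′ ] ++ ([ + h ] ++ (P ++ [ - (+ 2) ])))))
      ↭⟨ prove 7 (v0 ⊕ (v1 ⊕ (v2 ⊕ (v3 ⊕ (v4 ⊕ (v5 ⊕ v6))))))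
                 ((v1 ⊕ (v6 ⊕ v0)) ⊕ (v5 ⊕ (v2 ⊕ (v3 ⊕ v4))))
                 ([ - (+ 1) ] V.∷ N V.∷ [ + (2 ℕ.+ (j ℕ.+ j)) ] V.∷ [ + h′ ] V.∷ [ + h ] V.∷ P V.∷ [ - (+ 2) ] V.∷ V.[]) ⟩
    (N ++ ([ - (+ 2) ] ++ [ - (+ 1) ])) ++ (P ++ ([ + (2 ℕ.+ (j ℕ.+ j)) ] ++ ([ + h′ ] ++ [ + h ])))
      ≡⟨ cong₂ _++_ (interval-join (- (+ h)) l₁ (n₁ (+ j)) (interval-join (- (+ 2)) 1 refl refl))
                    (interval-join (+ 1) l₂ refl (interval-join _ 1 (+1-on-right _) (interval-join _ 1 (+1-on-right _) refl))) ⟩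
    interval (- (+ h)) (l₁ ℕ.+ (1 ℕ.+ 1)) ++ interval (+ 1) (l₂ ℕ.+ (1 ℕ.+ (1 ℕ.+ 1)))
      ≡⟨ cong₂ (λ m n → interval (- (+ h)) m ++ interval (+ 1) n) (count₁ j) (count₂ j) ⟩
    interval (- (+ h)) h ++ interval (+ 1) h ∎
    where
    open PermutationReasoning
    v0 v1 v2 v3 v4 v5 v6 : Expr 7
    v0 = var (# 0); v1 = var (# 1); v2 = var (# 2); v3 = var (# 3)
    v4 = var (# 4); v5 = var (# 5); v6 = var (# 6)
    N P : List ℤ
    N = interval (- (+ h)) l₁
    P = interval (+ 1) l₂
    s₁ : ∀ J → - (+ 1) + - (+ 3 + (J + J)) ≡ - (+ 4 + (J + J))
    s₁ = solve-∀
    u : ∀ J → (- (+ 1) + (+ 1 + J)) + (+ 2 + J) ≡ + 2 + (J + J)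
    u = solve-∀
    v : ∀ J → (+ 2 + J) + (+ 1 + J) ≡ + 3 + (J + J)
    v = solve-∀
    w : ∀ J → (+ 1 + J) + (+ 3 + J) ≡ + 4 + (J + J)
    w = solve-∀
    s₂ : ∀ J → (+ 3 + J) + - (+ 2 + J) ≡ + 1
    s₂ = solve-∀
    t : ∀ J → - (+ 2 + J) + J ≡ - (+ 2)
    t = solve-∀
    n₁ : ∀ J → - (+ 2) ≡ - (+ 4 + (J + J)) + (+ 1 + (J + (+ 1 + J)))
    n₁ = solve-∀
    count₁ : ∀ i → suc i ℕ.+ suc i ℕ.+ (1 ℕ.+ 1) ≡ 4 ℕ.+ (i ℕ.+ i)
    count₁ = NS.solve-∀
    count₂ : ∀ i → suc (i ℕ.+ i) ℕ.+ (1 ℕ.+ (1 ℕ.+ 1)) ≡ 4 ℕ.+ (i ℕ.+ i)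
    count₂ = NS.solve-∀

  superEdgeGraceful : SuperEdgeGraceful (Path (h * 2))
  superEdgeGraceful =
    pathSEG edges (trans (length-twoZigs x₁ l₁ c d e x₂ l₂) (count j)) (enumOdd h′) (enumEven h) edges-↭ vertices-↭
    where
    count : ∀ i → 2 ℕ.+ (i ℕ.+ (1 ℕ.+ i) ℕ.+ (4 ℕ.+ (i ℕ.+ i))) ≡ suc ((3 ℕ.+ (i ℕ.+ i)) * 2)
    count = NS.solve-∀

halves : ∀ n → (∃[ h ] n ≡ h * 2) ⊎ (∃[ h ] n ≡ suc (h * 2))
halves zero = inj₁ (0 , refl)
halves (suc n) with halves n
... | inj₁ (h , refl) = inj₂ (h , refl)
... | inj₂ (h , refl) = inj₁ (suc h , refl)

evenPath : ∀ h → SuperEdgeGraceful (Path ((3 ℕ.+ h) * 2))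
evenPath h with halves h
... | inj₁ (j , refl) = subst (λ k → SuperEdgeGraceful (Path ((3 ℕ.+ k) * 2))) (double j) (EvenPathOddHalf.superEdgeGraceful j)
... | inj₂ (j , refl) = subst (λ k → SuperEdgeGraceful (Path ((4 ℕ.+ k) * 2))) (double j) (EvenPathEvenHalf.superEdgeGraceful j)

-- P_2: the single edge must get label 0, which is then also a vertex label.
P₂-not : ¬ SuperEdgeGraceful (Path 2)
P₂-not (f , (edgeLabel , _ , _) , (vertexLabel , _ , _)) =
  proj₁ (vertexLabel zero) (trans (ℤP.+-identityʳ (f zero)) f₀≡0)
  where
  f₀≡0 : f zero ≡ + 0
  f₀≡0 = ℤP.≤-antisym (proj₂ (edgeLabel zero)) (proj₁ (edgeLabel zero))

-- P_4: the edge labelled 0 makes an end vertex 0 (first or last edge) or gives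
-- vertices 0 and 1 the same label (middle edge).
P₄-not : ¬ SuperEdgeGraceful (Path 4)
P₄-not (f , (_ , _ , edgeOnto) , (vertexLabel , vertexInj , _)) with edgeOnto (+ 0) (-≤+ , +≤+ z≤n)
... | zero , f₀≡0 = proj₁ (vertexLabel zero) (trans (ℤP.+-identityʳ (f zero)) f₀≡0)
... | suc zero , f₁≡0 with vertexInj zero (suc zero) (sym (cong (λ t → f zero + (t + + 0)) f₁≡0))
...   | ()
P₄-not (f , (_ , _ , edgeOnto) , (vertexLabel , _ , _)) | suc (suc zero) , f₂≡0 =
  proj₁ (vertexLabel (suc (suc (suc zero))))
    (trans (ℤP.+-identityˡ _) (trans (ℤP.+-identityˡ _) (trans (ℤP.+-identityʳ (f (suc (suc zero)))) f₂≡0)))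

theorem1 : (∀ (n : ℕ) → n ≢ 0 → n ≢ 2 → n ≢ 4 → SuperEdgeGraceful (Path n))
    × (¬ SuperEdgeGraceful (Path 2) × ¬ SuperEdgeGraceful (Path 4))
theorem1 = paths , P₂-not , P₄-not
  where
  paths : ∀ (n : ℕ) → n ≢ 0 → n ≢ 2 → n ≢ 4 → SuperEdgeGraceful (Path n)
  paths n n≢0 n≢2 n≢4 with halves n
  ... | inj₂ (h , refl)                   = oddPath h
  ... | inj₁ (0 , refl)                   = ⊥-elim (n≢0 refl)
  ... | inj₁ (1 , refl)                   = ⊥-elim (n≢2 refl)
  ... | inj₁ (2 , refl)                   = ⊥-elim (n≢4 refl)
  ... | inj₁ (suc (suc (suc h)) , refl)   = evenPath h
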